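{- Let $\mathcal{F}$ be a dominance monotone set of graphs such that no graph in $\mathcal{F}$ has a dominating vertex. Then $\overline{\mathcal{F}}=\{\overline{F}: F\in\mathcal{F}\}$ is dominance monotone as well.
   Context: All graphs are finite and simple. A degree sequence is written as a list of nonnegative integers in nonincreasing order. For lists $d=(d_1,\dots,d_n)$ and $e=(e_1,\dots,e_p)$ of positive integers in nonincreasing order, $d$ majorizes $e$, written $d\succeq e$, if $\sum_{i=1}^n d_i=\sum_{i=1}^p e_i$ and $\sum_{i=1}^k e_i\le\sum_{i=1}^k d_i$ for $1\le k\le\min\{p,n\}$. The dominance order $\mathcal{D}_{2m}$ is the set of degree sequences of simple graphs with all terms positive and sum $2m$, ordered by $\succeq$. A realization of a degree sequence is a graph with that degree sequence. For a set $\mathcal{F}$ of graphs, a graph is $\mathcal{F}$-free if it contains no induced subgraph isomorphic to an element of $\mathcal{F}$; a degree sequence is forcibly $\mathcal{F}$-free if every realization of it is $\mathcal{F}$-free. A set $\mathcal{F}$ is dominance monotone if whenever $d,e$ are degree sequences (with positive terms) with $d\succeq e$ and $e$ forcibly $\mathcal{F}$-free, then $d$ is forcibly $\mathcal{F}$-free. A dominating vertex of a graph $G$ is a vertex of degree $|V(G)|-1$. $\overline{G}$ denotes the complement of $G$. -}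

module Defs where

open import Data.Nat using (ℕ; _≤_; _≥_; _∸_; _⊓_)
open import Data.Bool using (Bool; true; false; if_then_else_)
open import Data.Fin using (Fin)
open import Data.List using (List; map; take; length; allFin)
open import Data.Nat.ListAction using (sum)
open import Data.List.Relation.Unary.All using (All)
open import Data.List.Relation.Unary.Linked using (Linked)
open import Data.List.Relation.Binary.Permutation.Propositional using (_↭_)
open import Data.Product using (Σ; _×_; ∃)
open import Relation.Binary.PropositionalEquality using (_≡_)
open import Relation.Nullary using (¬_)
open import Function.Definitions using (Injective)

record Graph : Set where
  field
    n      : ℕ
    adj    : Fin n → Fin n → Bool
    adj-sym : ∀ i j → adj i j ≡ adj j i
    adj-irr : ∀ i → adj i i ≡ false
open Graph public

complement : Graph → Graph
complement G = record
  { n = n G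
  ; adj = λ i j → if adj G i j then false else (irr i j)
  ; adj-sym = λ i j → lemma i j
  ; adj-irr = λ i → irrI i
  }
  where
  open import Data.Fin using (_≟_)
  open import Relation.Nullary using (yes; no)
  open import Relation.Binary.PropositionalEquality using (refl; sym; cong)
  irr : Fin (n G) → Fin (n G) → Bool
  irr i j with i ≟ j
  ... | yes _ = false
  ... | no _ = true
  irrI : ∀ i → (if adj G i i then false else irr i i) ≡ false
  irrI i with adj G i i
  ... | true = refl
  ... | false with i ≟ i
  ...   | yes _ = refl
  ...   | no i≢i = Data.Empty.⊥-elim (i≢i refl)
    where import Data.Empty
  irrSym : ∀ i j → irr i j ≡ irr j i
  irrSym i j with i ≟ j | j ≟ i
  ... | yes _ | yes _ = refl
  ... | no _ | no _ = refl
  ... | yes p | no q = Data.Empty.⊥-elim (q (sym p))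
    where import Data.Empty
  ... | no p | yes q = Data.Empty.⊥-elim (p (sym q))
    where import Data.Empty
  lemma : ∀ i j → (if adj G i j then false else irr i j) ≡ (if adj G j i then false else irr j i)
  lemma i j rewrite adj-sym G i j | irrSym i j = refl

deg : (G : Graph) → Fin (n G) → ℕ
deg G i = sum (map (λ j → if adj G i j then 1 else 0) (allFin (n G)))

degrees : Graph → List ℕ
degrees G = map (deg G) (allFin (n G))

HasDominatingVertex : Graph → Set
HasDominatingVertex G = ∃ λ (i : Fin (n G)) → deg G i ≡ n G ∸ 1

NonIncreasing : List ℕ → Set
NonIncreasing = Linked _≥_

Positive : List ℕ → Set
Positive = All (λ x → 1 ≤ x)

Realizes : Graph → List ℕ → Set
Realizes G d = degrees G ↭ d

IsDegSeq : List ℕ → Set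
IsDegSeq d = NonIncreasing d × Positive d × Σ Graph (λ G → Realizes G d)

_⪰_ : List ℕ → List ℕ → Set
d ⪰ e = (sum d ≡ sum e) ×
        (∀ k → 1 ≤ k → k ≤ length e ⊓ length d → sum (take k e) ≤ sum (take k d))

ContainsInduced : Graph → Graph → Set
ContainsInduced G H =
  Σ (Fin (n H) → Fin (n G)) λ f → Injective _≡_ _≡_ f × (∀ i j → adj H i j ≡ adj G (f i) (f j))

GraphSet : Set₁
GraphSet = Graph → Set

Free : GraphSet → Graph → Set
Free 𝓕 G = ∀ F → 𝓕 F → ¬ ContainsInduced G F

ForciblyFree : GraphSet → List ℕ → Set
ForciblyFree 𝓕 d = ∀ G → Realizes G d → Free 𝓕 G

DominanceMonotone : GraphSet → Set
DominanceMonotone 𝓕 =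
  ∀ d e → IsDegSeq d → IsDegSeq e → d ⪰ e → ForciblyFree 𝓕 e → ForciblyFree 𝓕 d

ComplementSet : GraphSet → GraphSet
ComplementSet 𝓕 H = Σ Graph λ F → 𝓕 F × (H ≡ complement F)

-- Let G realize d, where d ⪰ e, and contain an induced F̄ with F ∈ 𝓕; say d has m and e has p
-- terms. Adding p + 1 isolated vertices to G and complementing gives a graph K on m + p + 1
-- vertices that contains F and realizes d′, the complement sequence of d padded with zeros.
-- Padding e with m + 1 zeros and complementing gives e′ on the same number of vertices, and
-- complementing on a common vertex set preserves majorization, so d′ ⪰ e′. A realization X
-- of e′ has m + 1 dominating vertices; an induced copy of F in X avoids them since F has no
-- dominating vertex, so deleting them leaves a graph whose complement realizes e and contains
-- F̄. Hence e′ is forcibly 𝓕-free, so is d′ by dominance monotonicity of 𝓕, contradicting K ⊇ F.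
module Submission where

open import Defs
open import Relation.Nullary using (¬_; Dec; yes; no; contradiction)

open import Data.Bool using (Bool; true; false; not; if_then_else_)
open import Data.Bool.Properties using (not-involutive)
open import Data.Empty using (⊥-elim)
open import Data.Fin as Fin using (Fin; zero; suc; punchIn; punchOut; _↑ˡ_; _↑ʳ_; splitAt)
open import Data.Fin.Properties
  using (punchInᵢ≢i; punchIn-punchOut; punchOut-injective; splitAt-↑ˡ; splitAt-↑ʳ; ↑ˡ-injective)
open import Data.List
  using (List; []; _∷_; _++_; _ʳ++_; map; tabulate; replicate; allFin; length; reverse; head; take; drop)
open import Data.List.Properties
  using ( length-++; length-replicate; length-reverse; length-drop; length-map; length-tabulate
        ; map-tabulate; map-cong; map-cong-local; map-∘; map-id; map-id-local; map-++; map-replicate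
        ; tabulate-cong; take-all; take-take; take++drop≡id; drop-map; reverse-++)
open import Data.List.Membership.Propositional.Properties using (∈-map⁻)
open import Data.List.Relation.Binary.Permutation.Propositional
  using (_↭_; ↭-refl; ↭-sym; ↭-trans; ↭-reflexive; prep; swap; module PermutationReasoning)
open import Data.List.Relation.Binary.Permutation.Propositional.Properties
  using (map⁺; drop-∷; ∈-resp-↭; ↭-length; All-resp-↭; ↭-reverse; ++⁺ʳ; ++-comm)
open import Data.List.Relation.Unary.All as All using (All; []; _∷_)
import Data.List.Relation.Unary.All.Properties as AllP
open import Data.List.Relation.Unary.Any using (here)
open import Data.List.Relation.Unary.Linked as Lk using (Linked; []; [-]; _∷_; _∷′_)
import Data.List.Relation.Unary.Linked.Properties as LkP
open import Data.Maybe using (just)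
open import Data.Maybe.Relation.Binary.Connected using (Connected; just; just-nothing; nothing-just)
open import Data.Nat
open import Data.Nat.ListAction using (sum)
open import Data.Nat.ListAction.Properties using (sum-↭; sum-++)
open import Data.Nat.Properties
open import Data.Product using (Σ; _×_; _,_; proj₁; proj₂)
open import Data.Sum using (_⊎_; inj₁; inj₂)
open import Function using (_∘_; id; flip)
open import Relation.Binary using (Rel)
open import Relation.Binary.PropositionalEquality

open import Algebra.Properties.CommutativeMonoid.Sum +-0-commutativeMonoid
  using (sum-cong-≗; ∑-distrib-+; sum-remove; sum-replicate-zero) renaming (sum to ∑)
open import Algebra.Properties.CommutativeSemigroup +-commutativeSemigroup using (interchange)

-- Finite sums and lists

sum-tabulate : ∀ {n} (f : Fin n → ℕ) → sum (tabulate f) ≡ ∑ f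
sum-tabulate {zero}  f = refl
sum-tabulate {suc n} f = cong (f zero +_) (sum-tabulate (f ∘ suc))

∑-ones : ∀ n → ∑ {n} (λ _ → 1) ≡ n
∑-ones zero    = refl
∑-ones (suc n) = cong suc (∑-ones n)

∑≡0⇒≡0 : ∀ {n} (f : Fin n → ℕ) → ∑ f ≡ 0 → ∀ i → f i ≡ 0
∑≡0⇒≡0 f ∑f≡0 zero    = m+n≡0⇒m≡0 (f zero) ∑f≡0
∑≡0⇒≡0 f ∑f≡0 (suc i) = ∑≡0⇒≡0 (f ∘ suc) (m+n≡0⇒n≡0 (f zero) ∑f≡0) i

∑-↑ : ∀ m {k} (f : Fin (m + k) → ℕ) → ∑ f ≡ ∑ (f ∘ (_↑ˡ k)) + ∑ (f ∘ (m ↑ʳ_))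
∑-↑ zero    f = refl
∑-↑ (suc m) f = trans (cong (f zero +_) (∑-↑ m (f ∘ suc))) (sym (+-assoc (f zero) _ _))

∑-ones-except : ∀ {n} (i : Fin n) (h : Fin n → ℕ) →
  h i ≡ 0 → (∀ j → j ≢ i → h j ≡ 1) → ∑ h ≡ n ∸ 1
∑-ones-except {suc n} i h hᵢ≡0 hⱼ≡1 = begin
  ∑ h                      ≡⟨ sum-remove h ⟩
  h i + ∑ (h ∘ punchIn i)  ≡⟨ cong₂ _+_ hᵢ≡0 (sum-cong-≗ (λ j → hⱼ≡1 (punchIn i j) (punchInᵢ≢i i j))) ⟩
  ∑ {n} (λ _ → 1)          ≡⟨ ∑-ones n ⟩
  n                        ∎
  where open ≡-Reasoning

tabulate-++ : ∀ {a} {A : Set a} m {k} (f : Fin (m + k) → A) →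
  tabulate f ≡ tabulate (f ∘ (_↑ˡ k)) ++ tabulate (f ∘ (m ↑ʳ_))
tabulate-++ zero    f = refl
tabulate-++ (suc m) f = cong (f zero ∷_) (tabulate-++ m (f ∘ suc))

tabulate-const : ∀ {a} {A : Set a} n (x : A) → tabulate {n = n} (λ _ → x) ≡ replicate n x
tabulate-const zero    x = refl
tabulate-const (suc n) x = cong (x ∷_) (tabulate-const n x)

tabulate-punchIn-↭ : ∀ {a} {A : Set a} {n} (f : Fin (suc n) → A) i →
  tabulate f ↭ f i ∷ tabulate (f ∘ punchIn i)
tabulate-punchIn-↭             f zero    = ↭-refl
tabulate-punchIn-↭ {n = suc n} f (suc i) =
  ↭-trans (prep (f zero) (tabulate-punchIn-↭ (f ∘ suc) i)) (swap (f zero) (f (suc i)) ↭-refl)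

take-length-++ : ∀ {a} {A : Set a} (U V : List A) → take (length U) (U ++ V) ≡ U
take-length-++ []      V = refl
take-length-++ (x ∷ U) V = cong (x ∷_) (take-length-++ U V)

take-reverse : ∀ {a} {A : Set a} j (X : List A) → j ≤ length X →
  take j (reverse X) ≡ reverse (drop (length X ∸ j) X)
take-reverse j X j≤|X| = begin
  take j (reverse X)
    ≡⟨ cong (take j ∘ reverse) (take++drop≡id i X) ⟨
  take j (reverse (take i X ++ drop i X))
    ≡⟨ cong (take j) (reverse-++ (take i X) (drop i X)) ⟩
  take j (reverse (drop i X) ++ reverse (take i X))
    ≡⟨ cong (λ m → take m (reverse (drop i X) ++ reverse (take i X))) |suffix|≡j ⟨
  take (length (reverse (drop i X))) (reverse (drop i X) ++ reverse (take i X))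
    ≡⟨ take-length-++ (reverse (drop i X)) (reverse (take i X)) ⟩
  reverse (drop i X) ∎
  where
  open ≡-Reasoning
  i : ℕ
  i = length X ∸ j
  |suffix|≡j : length (reverse (drop i X)) ≡ j
  |suffix|≡j = trans (length-reverse (drop i X)) (trans (length-drop i X) (m∸[m∸n]≡n j≤|X|))

sum-take+sum-drop : ∀ j L → sum (take j L) + sum (drop j L) ≡ sum L
sum-take+sum-drop j L = trans (sym (sum-++ (take j L) (drop j L))) (cong sum (take++drop≡id j L))

sum-take≤sum : ∀ j L → sum (take j L) ≤ sum L
sum-take≤sum j L = subst (sum (take j L) ≤_) (sum-take+sum-drop j L) (m≤m+n _ _)

sum-take-mono : ∀ {i j} L → i ≤ j → sum (take i L) ≤ sum (take j L)
sum-take-mono {i} {j} L i≤j = subst (λ xs → sum xs ≤ sum (take j L))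
  (trans (take-take i j L) (cong (λ m → take m L) (m≤n⇒m⊓n≡m i≤j))) (sum-take≤sum i (take j L))

sum-replicate-0 : ∀ k → sum (replicate k 0) ≡ 0
sum-replicate-0 zero    = refl
sum-replicate-0 (suc k) = sum-replicate-0 k

sum-take-replicate-0 : ∀ j k → sum (take j (replicate k 0)) ≡ 0
sum-take-replicate-0 zero    k       = refl
sum-take-replicate-0 (suc j) zero    = refl
sum-take-replicate-0 (suc j) (suc k) = sum-take-replicate-0 j k

sum-++-zeros : ∀ L k → sum (L ++ replicate k 0) ≡ sum L
sum-++-zeros L k =
  trans (sum-++ L (replicate k 0)) (trans (cong (sum L +_) (sum-replicate-0 k)) (+-identityʳ (sum L)))

sum-take-++-zeros : ∀ j L k → sum (take j (L ++ replicate k 0)) ≡ sum (take j L)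
sum-take-++-zeros zero    L       k = refl
sum-take-++-zeros (suc j) []      k = sum-take-replicate-0 (suc j) k
sum-take-++-zeros (suc j) (x ∷ L) k = cong (x +_) (sum-take-++-zeros j L k)

private
  m+n≡o+p⇒o≤m⇒n≤p : ∀ {m n o p} → m + n ≡ o + p → o ≤ m → n ≤ p
  m+n≡o+p⇒o≤m⇒n≤p {m} {n} {o} {p} eq o≤m =
    +-cancelˡ-≤ o n p (subst (o + n ≤_) eq (+-monoˡ-≤ n o≤m))

sum-map-∸ : ∀ c Z → All (_≤ c) Z → sum Z + sum (map (c ∸_) Z) ≡ length Z * c
sum-map-∸ c []      []           = refl
sum-map-∸ c (x ∷ Z) (x≤c ∷ Z≤c) = begin
  (x + sum Z) + ((c ∸ x) + sum (map (c ∸_) Z)) ≡⟨ interchange x (sum Z) (c ∸ x) _ ⟩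
  (x + (c ∸ x)) + (sum Z + sum (map (c ∸_) Z)) ≡⟨ cong₂ _+_ (m+[n∸m]≡n x≤c) (sum-map-∸ c Z Z≤c) ⟩
  c + length Z * c                               ∎
  where open ≡-Reasoning

sum-map-∸-antitone : ∀ {c Z W} → length Z ≡ length W → All (_≤ c) Z → All (_≤ c) W →
  sum Z ≤ sum W → sum (map (c ∸_) W) ≤ sum (map (c ∸_) Z)
sum-map-∸-antitone {c} {Z} {W} |Z|≡|W| Z≤c W≤c = m+n≡o+p⇒o≤m⇒n≤p
  (trans (sum-map-∸ c W W≤c) (trans (cong (_* c) (sym |Z|≡|W|)) (sym (sum-map-∸ c Z Z≤c))))

module _ {a ℓ} {A : Set a} {R : Rel A ℓ} where

  private
    head-flip : ∀ {x xs} → Linked R (x ∷ xs) → Connected (flip R) (head xs) (just x)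
    head-flip [-]       = nothing-just
    head-flip (Rxy ∷ _) = just Rxy

  ʳ++⁺ : ∀ {xs ys} → Linked R xs → Linked (flip R) ys →
         Connected (flip R) (head xs) (head ys) → Linked (flip R) (xs ʳ++ ys)
  ʳ++⁺ {[]}     _    Rys _ = Rys
  ʳ++⁺ {_ ∷ _} Rxs Rys c = ʳ++⁺ (Lk.tail Rxs) (c ∷′ Rys) (head-flip Rxs)

  reverse⁺ : ∀ {xs} → Linked R xs → Linked (flip R) (reverse xs)
  reverse⁺ {[]}    _   = []
  reverse⁺ {_ ∷ _} Rxs = ʳ++⁺ Rxs [] just-nothing

replicate-nonIncreasing : ∀ k x → NonIncreasing (replicate k x)
replicate-nonIncreasing zero          x = []
replicate-nonIncreasing (suc zero)    x = [-]
replicate-nonIncreasing (suc (suc k)) x = ≤-refl ∷ replicate-nonIncreasing (suc k) x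

++-zeros-nonIncreasing : ∀ k {L} → NonIncreasing L → NonIncreasing (L ++ replicate k 0)
++-zeros-nonIncreasing k       []          = replicate-nonIncreasing k 0
++-zeros-nonIncreasing zero    [-]         = [-]
++-zeros-nonIncreasing (suc k) [-]         = z≤n ∷ replicate-nonIncreasing (suc k) 0
++-zeros-nonIncreasing k       (x≥y ∷ L↘) = x≥y ∷ ++-zeros-nonIncreasing k L↘

-- Degrees in a graph and its complement

fromBool : Bool → ℕ
fromBool b = if b then 1 else 0

fromBool-not : ∀ b → fromBool (not b) + fromBool b ≡ 1
fromBool-not true  = refl
fromBool-not false = refl

fromBool≡0 : ∀ {b} → fromBool b ≡ 0 → b ≡ false
fromBool≡0 {false} _ = refl

deg≡∑ : ∀ G i → deg G i ≡ ∑ (fromBool ∘ adj G i)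
deg≡∑ G i = trans (cong sum (map-tabulate id (fromBool ∘ adj G i))) (sum-tabulate (fromBool ∘ adj G i))

degrees≡tabulate : ∀ G → degrees G ≡ tabulate (deg G)
degrees≡tabulate G = map-tabulate id (deg G)

length-degrees : ∀ G → length (degrees G) ≡ n G
length-degrees G = trans (length-map (deg G) (allFin (n G))) (length-tabulate id)

adj-complement : ∀ G {i j} → i ≢ j → adj (complement G) i j ≡ not (adj G i j)
adj-complement G {i} {j} i≢j with adj G i j | i Fin.≟ j
... | true  | _       = refl
... | false | yes i≡j = ⊥-elim (i≢j i≡j)
... | false | no _    = refl

-- A 'with' on i ≟ j would also abstract the same test inside complement's adjacency, so
-- case splits on it go through a function on Dec here and below.
adj-complement-involutive : ∀ G i j → adj (complement (complement G)) i j ≡ adj G i j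
adj-complement-involutive G i j = by-cases (i Fin.≟ j)
  where
  open ≡-Reasoning
  by-cases : Dec (i ≡ j) → adj (complement (complement G)) i j ≡ adj G i j
  by-cases (yes i≡j) = subst (λ j → adj (complement (complement G)) i j ≡ adj G i j) i≡j
                         (trans (adj-irr (complement (complement G)) i) (sym (adj-irr G i)))
  by-cases (no i≢j)  = begin
    adj (complement (complement G)) i j ≡⟨ adj-complement (complement G) i≢j ⟩
    not (adj (complement G) i j)        ≡⟨ cong not (adj-complement G i≢j) ⟩
    not (not (adj G i j))               ≡⟨ not-involutive _ ⟩
    adj G i j                           ∎

deg-complement : ∀ G i → deg (complement G) i + deg G i ≡ n G ∸ 1
deg-complement G i = begin
  deg (complement G) i + deg G i
    ≡⟨ cong₂ _+_ (deg≡∑ (complement G) i) (deg≡∑ G i) ⟩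
  ∑ (fromBool ∘ adj (complement G) i) + ∑ (fromBool ∘ adj G i)
    ≡⟨ ∑-distrib-+ (fromBool ∘ adj (complement G) i) (fromBool ∘ adj G i) ⟨
  ∑ (λ j → fromBool (adj (complement G) i j) + fromBool (adj G i j))
    ≡⟨ ∑-ones-except i _ loop other ⟩
  n G ∸ 1 ∎
  where
  open ≡-Reasoning
  loop : fromBool (adj (complement G) i i) + fromBool (adj G i i) ≡ 0
  loop = cong₂ (λ a b → fromBool a + fromBool b) (adj-irr (complement G) i) (adj-irr G i)
  other : ∀ j → j ≢ i → fromBool (adj (complement G) i j) + fromBool (adj G i j) ≡ 1
  other j j≢i = trans (cong (λ a → fromBool a + fromBool (adj G i j)) (adj-complement G (j≢i ∘ sym)))
                      (fromBool-not (adj G i j))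

deg-complement-∸ : ∀ G i → deg (complement G) i ≡ (n G ∸ 1) ∸ deg G i
deg-complement-∸ G i = trans (sym (m+n∸n≡m _ (deg G i))) (cong (_∸ deg G i) (deg-complement G i))

degrees-complement : ∀ G → degrees (complement G) ≡ map ((n G ∸ 1) ∸_) (degrees G)
degrees-complement G = trans (map-cong (deg-complement-∸ G) (allFin (n G))) (map-∘ (allFin (n G)))

deg<n : ∀ G i → deg G i < n G
deg<n G i = ≤-<-trans (subst (deg G i ≤_) (deg-complement G i) (m≤n+m _ _)) (pred< i)
  where
  pred< : ∀ {m} → Fin m → m ∸ 1 < m
  pred< {suc m} _ = n<1+n m

deg≡0⇒¬adj : ∀ G i → deg G i ≡ 0 → ∀ j → adj G i j ≡ false
deg≡0⇒¬adj G i deg≡0 j =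
  fromBool≡0 (∑≡0⇒≡0 (fromBool ∘ adj G i) (trans (sym (deg≡∑ G i)) deg≡0) j)

¬adj⇒deg≡0 : ∀ G i → (∀ j → adj G i j ≡ false) → deg G i ≡ 0
¬adj⇒deg≡0 G i ¬adj =
  trans (deg≡∑ G i) (trans (sum-cong-≗ (cong fromBool ∘ ¬adj)) (sum-replicate-zero (n G)))

dominating⇒adj : ∀ G {w} → deg G w ≡ n G ∸ 1 → ∀ {v} → w ≢ v → adj G w v ≡ true
dominating⇒adj G {w} w-dom {v} w≢v = begin
  adj G w v                    ≡⟨ not-involutive _ ⟨
  not (not (adj G w v))        ≡⟨ cong not (adj-complement G w≢v) ⟨
  not (adj (complement G) w v) ≡⟨ cong not (deg≡0⇒¬adj (complement G) w isolated v) ⟩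
  true                         ∎
  where
  open ≡-Reasoning
  isolated : deg (complement G) w ≡ 0
  isolated = +-cancelʳ-≡ (deg G w) _ 0 (trans (deg-complement G w) (sym w-dom))

adj⇒dominating : ∀ G {w} → (∀ {v} → w ≢ v → adj G w v ≡ true) → deg G w ≡ n G ∸ 1
adj⇒dominating G {w} adj-all = trans (cong (_+ deg G w) (sym isolated)) (deg-complement G w)
  where
  ¬adj : ∀ v → adj (complement G) w v ≡ false
  ¬adj v = by-cases (w Fin.≟ v)
    where
    by-cases : Dec (w ≡ v) → adj (complement G) w v ≡ false
    by-cases (yes w≡v) = subst (λ v → adj (complement G) w v ≡ false) w≡v (adj-irr (complement G) w)
    by-cases (no w≢v)  = trans (adj-complement G w≢v) (cong not (adj-all w≢v))
  isolated : deg (complement G) w ≡ 0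
  isolated = ¬adj⇒deg≡0 (complement G) w ¬adj

complement-⊇ : ∀ G H → ContainsInduced G H → ContainsInduced (complement G) (complement H)
complement-⊇ G H (f , f-inj , f-adj) = f , f-inj , λ i j → by-cases i j (i Fin.≟ j)
  where
  by-cases : ∀ i j → Dec (i ≡ j) → adj (complement H) i j ≡ adj (complement G) (f i) (f j)
  by-cases i j (yes i≡j) = subst (λ j → adj (complement H) i j ≡ adj (complement G) (f i) (f j)) i≡j
                             (trans (adj-irr (complement H) i) (sym (adj-irr (complement G) (f i))))
  by-cases i j (no i≢j)  = trans (adj-complement H i≢j)
    (trans (cong not (f-adj i j)) (sym (adj-complement G (i≢j ∘ f-inj))))

⊇-double-complement : ∀ G H → ContainsInduced G (complement (complement H)) → ContainsInduced G H
⊇-double-complement G H (f , f-inj , f-adj) =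
  f , f-inj , λ i j → trans (sym (adj-complement-involutive H i j)) (f-adj i j)

-- Adding isolated vertices and deleting dominating vertices

addIsolated : Graph → ℕ → Graph
addIsolated G k = record
  { n       = n G + k
  ; adj     = λ u v → adj⊎ (splitAt (n G) u) (splitAt (n G) v)
  ; adj-sym = λ u v → adj⊎-sym (splitAt (n G) u) (splitAt (n G) v)
  ; adj-irr = λ u → adj⊎-irr (splitAt (n G) u)
  }
  where
  adj⊎ : Fin (n G) ⊎ Fin k → Fin (n G) ⊎ Fin k → Bool
  adj⊎ (inj₁ i) (inj₁ j) = adj G i j
  adj⊎ _        _        = false
  adj⊎-sym : ∀ x y → adj⊎ x y ≡ adj⊎ y x
  adj⊎-sym (inj₁ i) (inj₁ j) = adj-sym G i j
  adj⊎-sym (inj₁ i) (inj₂ j) = refl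
  adj⊎-sym (inj₂ i) (inj₁ j) = refl
  adj⊎-sym (inj₂ i) (inj₂ j) = refl
  adj⊎-irr : ∀ x → adj⊎ x x ≡ false
  adj⊎-irr (inj₁ i) = adj-irr G i
  adj⊎-irr (inj₂ i) = refl

module _ (G : Graph) (k : ℕ) where

  adj-addIsolated-↑ˡ : ∀ i j → adj (addIsolated G k) (i ↑ˡ k) (j ↑ˡ k) ≡ adj G i j
  adj-addIsolated-↑ˡ i j rewrite splitAt-↑ˡ (n G) i k | splitAt-↑ˡ (n G) j k = refl

  adj-addIsolated-↑ˡ↑ʳ : ∀ i j → adj (addIsolated G k) (i ↑ˡ k) (n G ↑ʳ j) ≡ false
  adj-addIsolated-↑ˡ↑ʳ i j rewrite splitAt-↑ˡ (n G) i k | splitAt-↑ʳ (n G) k j = refl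

  adj-addIsolated-↑ʳ : ∀ i v → adj (addIsolated G k) (n G ↑ʳ i) v ≡ false
  adj-addIsolated-↑ʳ i v rewrite splitAt-↑ʳ (n G) k i = refl

  deg-addIsolated-↑ˡ : ∀ i → deg (addIsolated G k) (i ↑ˡ k) ≡ deg G i
  deg-addIsolated-↑ˡ i = begin
    deg (addIsolated G k) (i ↑ˡ k)
      ≡⟨ deg≡∑ (addIsolated G k) (i ↑ˡ k) ⟩
    ∑ (fromBool ∘ adj (addIsolated G k) (i ↑ˡ k))
      ≡⟨ ∑-↑ (n G) _ ⟩
    ∑ (λ j → fromBool (adj (addIsolated G k) (i ↑ˡ k) (j ↑ˡ k)))
      + ∑ (λ j → fromBool (adj (addIsolated G k) (i ↑ˡ k) (n G ↑ʳ j)))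
      ≡⟨ cong₂ _+_ (sum-cong-≗ (cong fromBool ∘ adj-addIsolated-↑ˡ i))
                   (trans (sum-cong-≗ (cong fromBool ∘ adj-addIsolated-↑ˡ↑ʳ i)) (sum-replicate-zero k)) ⟩
    ∑ (fromBool ∘ adj G i) + 0
      ≡⟨ +-identityʳ _ ⟩
    ∑ (fromBool ∘ adj G i)
      ≡⟨ deg≡∑ G i ⟨
    deg G i ∎
    where open ≡-Reasoning

  degrees-addIsolated : degrees (addIsolated G k) ≡ degrees G ++ replicate k 0
  degrees-addIsolated = begin
    degrees (addIsolated G k)
      ≡⟨ degrees≡tabulate (addIsolated G k) ⟩
    tabulate (deg (addIsolated G k))
      ≡⟨ tabulate-++ (n G) (deg (addIsolated G k)) ⟩
    tabulate (deg (addIsolated G k) ∘ (_↑ˡ k)) ++ tabulate (deg (addIsolated G k) ∘ (n G ↑ʳ_))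
      ≡⟨ cong₂ _++_ (tabulate-cong deg-addIsolated-↑ˡ) (tabulate-cong isolated) ⟩
    tabulate (deg G) ++ tabulate (λ _ → 0)
      ≡⟨ cong₂ _++_ (sym (degrees≡tabulate G)) (tabulate-const k 0) ⟩
    degrees G ++ replicate k 0 ∎
    where
    open ≡-Reasoning
    isolated : ∀ i → deg (addIsolated G k) (n G ↑ʳ i) ≡ 0
    isolated i = ¬adj⇒deg≡0 (addIsolated G k) (n G ↑ʳ i) (adj-addIsolated-↑ʳ i)

  ⊇-addIsolated : ∀ H → ContainsInduced G H → ContainsInduced (addIsolated G k) H
  ⊇-addIsolated H (f , f-inj , f-adj) =
    (_↑ˡ k) ∘ f , f-inj ∘ ↑ˡ-injective k _ _ ,
    λ i j → trans (f-adj i j) (sym (adj-addIsolated-↑ˡ (f i) (f j)))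

map-∸1-shift : ∀ k m (β : List ℕ) →
  map (_∸ 1) (replicate k m ++ map (_+ suc k) β) ≡ replicate k (m ∸ 1) ++ map (_+ k) β
map-∸1-shift k m β = begin
  map (_∸ 1) (replicate k m ++ map (_+ suc k) β)
    ≡⟨ map-++ (_∸ 1) (replicate k m) (map (_+ suc k) β) ⟩
  map (_∸ 1) (replicate k m) ++ map (_∸ 1) (map (_+ suc k) β)
    ≡⟨ cong₂ _++_ (map-replicate (_∸ 1) k m) (sym (map-∘ β)) ⟩
  replicate k (m ∸ 1) ++ map (λ x → x + suc k ∸ 1) β
    ≡⟨ cong (replicate k (m ∸ 1) ++_) (map-cong (λ x → cong (_∸ 1) (+-suc x k)) β) ⟩
  replicate k (m ∸ 1) ++ map (_+ k) β ∎
  where open ≡-Reasoning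

map-suc-↭ : ∀ {xs ys} → map suc xs ↭ ys → xs ↭ map (_∸ 1) ys
map-suc-↭ {xs} p = ↭-trans (↭-reflexive (trans (sym (map-id xs)) (map-∘ xs))) (map⁺ (_∸ 1) p)

deleteDominatingVertex : ∀ X (w : Fin (n X)) → deg X w ≡ n X ∸ 1 →
  Σ Graph λ Y → n X ≡ suc (n Y) × degrees X ↭ n Y ∷ map suc (degrees Y)
              × (∀ F → ¬ HasDominatingVertex F → ContainsInduced X F → ContainsInduced Y F)
deleteDominatingVertex X@record { n = suc r ; adj = a ; adj-sym = a-sym ; adj-irr = a-irr } w w-dom =
  Y , refl , degrees-↭ , ⊇-Y
  where
  Y : Graph
  Y = record
    { n       = r
    ; adj     = λ i j → a (punchIn w i) (punchIn w j)
    ; adj-sym = λ i j → a-sym (punchIn w i) (punchIn w j)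
    ; adj-irr = λ i → a-irr (punchIn w i)
    }
  w∼ : ∀ {v} → w ≢ v → a w v ≡ true
  w∼ = dominating⇒adj X w-dom
  deg-punchIn : ∀ i → deg X (punchIn w i) ≡ suc (deg Y i)
  deg-punchIn i = begin
    deg X (punchIn w i)
      ≡⟨ deg≡∑ X (punchIn w i) ⟩
    ∑ (fromBool ∘ a (punchIn w i))
      ≡⟨ sum-remove (fromBool ∘ a (punchIn w i)) ⟩
    fromBool (a (punchIn w i) w) + ∑ (fromBool ∘ a (punchIn w i) ∘ punchIn w)
      ≡⟨ cong₂ _+_ (cong fromBool (trans (a-sym (punchIn w i) w) (w∼ (punchInᵢ≢i w i ∘ sym))))
                   (sym (deg≡∑ Y i)) ⟩
    suc (deg Y i) ∎
    where open ≡-Reasoning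
  degrees-↭ : degrees X ↭ r ∷ map suc (degrees Y)
  degrees-↭ = begin
    degrees X                             ≡⟨ degrees≡tabulate X ⟩
    tabulate (deg X)                      ↭⟨ tabulate-punchIn-↭ (deg X) w ⟩
    deg X w ∷ tabulate (deg X ∘ punchIn w) ≡⟨ cong₂ _∷_ w-dom (tabulate-cong deg-punchIn) ⟩
    r ∷ tabulate (suc ∘ deg Y)            ≡⟨ cong (r ∷_) (map-tabulate (deg Y) suc) ⟨
    r ∷ map suc (tabulate (deg Y))        ≡⟨ cong (λ xs → r ∷ map suc xs) (degrees≡tabulate Y) ⟨
    r ∷ map suc (degrees Y)               ∎
    where open PermutationReasoning
  ⊇-Y : ∀ F → ¬ HasDominatingVertex F → ContainsInduced X F → ContainsInduced Y F
  ⊇-Y F F-nodom (f , f-inj , f-adj) = g , g-inj , g-adj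
    where
    -- an i with f i = w would be adjacent to every other vertex of F
    w≢f : ∀ i → w ≢ f i
    w≢f i w≡fi = F-nodom (i , adj⇒dominating F λ {v} i≢v →
      trans (f-adj i v) (subst (λ u → a u (f v) ≡ true) w≡fi (w∼ (i≢v ∘ f-inj ∘ trans (sym w≡fi)))))
    g : Fin (n F) → Fin r
    g i = punchOut (w≢f i)
    g-inj : ∀ {i j} → g i ≡ g j → i ≡ j
    g-inj {i} {j} = f-inj ∘ punchOut-injective (w≢f i) (w≢f j)
    g-adj : ∀ i j → adj F i j ≡ adj Y (g i) (g j)
    g-adj i j = trans (f-adj i j) (sym (cong₂ a (punchIn-punchOut (w≢f i)) (punchIn-punchOut (w≢f j))))

deleteDominatingVertices : ∀ k β X → degrees X ↭ replicate k (n X ∸ 1) ++ map (_+ k) β →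
  ∀ F → ¬ HasDominatingVertex F → ContainsInduced X F →
  Σ Graph λ Y → degrees Y ↭ β × ContainsInduced Y F
deleteDominatingVertices zero β X X↭ F _ X⊇F =
  X , ↭-trans X↭ (↭-reflexive (trans (map-cong +-identityʳ β) (map-id β))) , X⊇F
deleteDominatingVertices (suc k) β X X↭ F F-nodom X⊇F
  with w , _ , w-dom ← ∈-map⁻ (deg X) (∈-resp-↭ (↭-sym X↭) (here refl))
  with Y , nX≡1+nY , X↭Y , ⊇-Y ← deleteDominatingVertex X w (sym w-dom)
  = deleteDominatingVertices k β Y Y↭ F F-nodom (⊇-Y F F-nodom X⊇F)
  where
  rest : List ℕ
  rest = replicate k (n Y) ++ map (_+ suc k) β
  X↭′ : degrees X ↭ n Y ∷ rest
  X↭′ = subst (λ m → degrees X ↭ replicate (suc k) m ++ map (_+ suc k) β) (cong (_∸ 1) nX≡1+nY) X↭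
  Y↭ : degrees Y ↭ replicate k (n Y ∸ 1) ++ map (_+ k) β
  Y↭ = ↭-trans (map-suc-↭ (drop-∷ (↭-trans (↭-sym X↭Y) X↭′)))
               (↭-reflexive (map-∸1-shift k (n Y) β))

-- Degree sequences and complement sequences

realizes⇒length : ∀ G {L} → Realizes G L → n G ≡ length L
realizes⇒length G G⇒L = trans (sym (length-degrees G)) (↭-length G⇒L)

realizes⇒bounded : ∀ G {L} → Realizes G L → All (_< n G) L
realizes⇒bounded G G⇒L =
  All-resp-↭ G⇒L (subst (All (_< n G)) (sym (degrees≡tabulate G)) (AllP.tabulate⁺ (deg<n G)))

isDegSeq⇒bounded : ∀ {L} → IsDegSeq L → All (_< length L) L
isDegSeq⇒bounded {L} (_ , _ , G , G⇒L) =
  subst (λ m → All (_< m) L) (realizes⇒length G G⇒L) (realizes⇒bounded G G⇒L)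

Positive-sum≡0⇒[] : ∀ {L} → Positive L → sum L ≡ 0 → L ≡ []
Positive-sum≡0⇒[] []               _    = refl
Positive-sum≡0⇒[] {x ∷ _} (x≥1 ∷ _) Σ≡0 =
  contradiction (subst (1 ≤_) (m+n≡0⇒m≡0 x Σ≡0) x≥1) n≮0

-- The degree list of the complement of a graph on c + 1 vertices with degree list L,
-- reversed so that nonincreasing lists stay nonincreasing.
complementSeq : ℕ → List ℕ → List ℕ
complementSeq c L = reverse (map (c ∸_) L)

length-complementSeq : ∀ c L → length (complementSeq c L) ≡ length L
length-complementSeq c L = trans (length-reverse (map (c ∸_) L)) (length-map (c ∸_) L)

sum-complementSeq : ∀ c L → sum (complementSeq c L) ≡ sum (map (c ∸_) L)
sum-complementSeq c L = sum-↭ (↭-reverse (map (c ∸_) L))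

length-++-replicate : ∀ (L : List ℕ) k {c} → length L + k ≡ c → length (L ++ replicate k 0) ≡ c
length-++-replicate L k |L|+k≡c = trans (length-++ L) (trans (cong (length L +_) (length-replicate k)) |L|+k≡c)

complement-addIsolated-realizes : ∀ {G L} k {c} → Realizes G L → length L + k ≡ suc c →
  Realizes (complement (addIsolated G k)) (complementSeq c (L ++ replicate k 0))
complement-addIsolated-realizes {G} {L} k {c} G⇒L |L|+k≡1+c = begin
  degrees (complement (addIsolated G k))
    ≡⟨ degrees-complement (addIsolated G k) ⟩
  map ((n G + k ∸ 1) ∸_) (degrees (addIsolated G k))
    ≡⟨ cong₂ (λ m xs → map (m ∸_) xs) n+k∸1≡c (degrees-addIsolated G k) ⟩
  map (c ∸_) (degrees G ++ replicate k 0)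
    ↭⟨ map⁺ (c ∸_) (++⁺ʳ (replicate k 0) G⇒L) ⟩
  map (c ∸_) (L ++ replicate k 0)
    ↭⟨ ↭-reverse (map (c ∸_) (L ++ replicate k 0)) ⟨
  complementSeq c (L ++ replicate k 0) ∎
  where
  open PermutationReasoning
  n+k∸1≡c : n G + k ∸ 1 ≡ c
  n+k∸1≡c = cong (_∸ 1) (trans (cong (_+ k) (realizes⇒length G G⇒L)) |L|+k≡1+c)

complementSeq-nonIncreasing : ∀ c {L} → NonIncreasing L → NonIncreasing (complementSeq c L)
complementSeq-nonIncreasing c L↘ = reverse⁺ (LkP.map⁺ (Lk.map (∸-monoʳ-≤ c) L↘))

complementSeq-positive : ∀ {c L} → All (_< c) L → Positive (complementSeq c L)
complementSeq-positive {c} {L} L<c =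
  All-resp-↭ (↭-sym (↭-reverse (map (c ∸_) L))) (AllP.map⁺ (All.map m<n⇒0<n∸m L<c))

-- Majorization

-- _⪰_ with the prefix inequality required at every length j (take j truncates).
infix 4 _≽_
_≽_ : List ℕ → List ℕ → Set
A ≽ B = sum A ≡ sum B × (∀ j → sum (take j B) ≤ sum (take j A))

≽⇒⪰ : ∀ {A B} → A ≽ B → A ⪰ B
≽⇒⪰ (Σ≡ , prefix) = Σ≡ , λ j _ _ → prefix j

⪰⇒≽ : ∀ {d e} → d ⪰ e → d ≽ e
⪰⇒≽ {d} {e} (Σ≡ , prefix) = Σ≡ , prefix′
  where
  open ≤-Reasoning
  prefix⁰ : ∀ j → j ≤ length e ⊓ length d → sum (take j e) ≤ sum (take j d)
  prefix⁰ zero    _ = z≤n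
  prefix⁰ (suc j)   = prefix (suc j) (s≤s z≤n)
  prefix′ : ∀ j → sum (take j e) ≤ sum (take j d)
  prefix′ j with j ≤? length e | j ≤? length d
  ... | yes j≤p | yes j≤n = prefix⁰ j (⊓-glb j≤p j≤n)
  ... | no j≰p  | yes j≤n = begin
    sum (take j e)          ≡⟨ cong sum (take-all j e p≤j) ⟩
    sum e                   ≡⟨ cong sum (take-all (length e) e ≤-refl) ⟨
    sum (take (length e) e) ≤⟨ prefix⁰ (length e) (⊓-glb ≤-refl (≤-trans p≤j j≤n)) ⟩
    sum (take (length e) d) ≤⟨ sum-take-mono d p≤j ⟩
    sum (take j d)          ∎
    where
    p≤j : length e ≤ j
    p≤j = <⇒≤ (≰⇒> j≰p)
  ... | _       | no j≰n  = begin
    sum (take j e) ≤⟨ sum-take≤sum j e ⟩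
    sum e          ≡⟨ Σ≡ ⟨
    sum d          ≡⟨ cong sum (take-all j d (<⇒≤ (≰⇒> j≰n))) ⟨
    sum (take j d) ∎

≽-++-zeros : ∀ {A B} k l → A ≽ B → A ++ replicate k 0 ≽ B ++ replicate l 0
≽-++-zeros {A} {B} k l (Σ≡ , prefix) =
  trans (sum-++-zeros A k) (trans Σ≡ (sym (sum-++-zeros B l))) ,
  λ j → subst₂ _≤_ (sym (sum-take-++-zeros j B l)) (sym (sum-take-++-zeros j A k)) (prefix j)

sum-drop-≤ : ∀ {A B} → A ≽ B → ∀ i → sum (drop i A) ≤ sum (drop i B)
sum-drop-≤ {A} {B} (Σ≡ , prefix) i = m+n≡o+p⇒o≤m⇒n≤p
  (trans (sum-take+sum-drop i A) (trans Σ≡ (sym (sum-take+sum-drop i B)))) (prefix i)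

sum-take-complementSeq : ∀ c L j → j ≤ length L →
  sum (take j (complementSeq c L)) ≡ sum (map (c ∸_) (drop (length L ∸ j) L))
sum-take-complementSeq c L j j≤|L| = begin
  sum (take j (complementSeq c L))
    ≡⟨ cong sum (take-reverse j (map (c ∸_) L) (subst (j ≤_) (sym (length-map (c ∸_) L)) j≤|L|)) ⟩
  sum (reverse (drop (length (map (c ∸_) L) ∸ j) (map (c ∸_) L)))
    ≡⟨ sum-↭ (↭-reverse (drop (length (map (c ∸_) L) ∸ j) (map (c ∸_) L))) ⟩
  sum (drop (length (map (c ∸_) L) ∸ j) (map (c ∸_) L))
    ≡⟨ cong (λ m → sum (drop (m ∸ j) (map (c ∸_) L))) (length-map (c ∸_) L) ⟩
  sum (drop (length L ∸ j) (map (c ∸_) L))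
    ≡⟨ cong sum (drop-map (length L ∸ j) L) ⟩
  sum (map (c ∸_) (drop (length L ∸ j) L)) ∎
  where open ≡-Reasoning

-- The first j terms of complementSeq c A are c ∸ x for the last j terms x of A, and A ≽ B
-- bounds the suffix sums of A by those of B.
complementSeq-≽ : ∀ {c A B} → length A ≡ length B → All (_≤ c) A → All (_≤ c) B →
  A ≽ B → complementSeq c A ≽ complementSeq c B
complementSeq-≽ {c} {A} {B} |A|≡|B| A≤c B≤c A≽B@(ΣA≡ΣB , _) = Σ≡ , prefix
  where
  Σ≡ : sum (complementSeq c A) ≡ sum (complementSeq c B)
  Σ≡ = begin-equality
    sum (complementSeq c A) ≡⟨ sum-complementSeq c A ⟩
    sum (map (c ∸_) A)      ≡⟨ ≤-antisym
                                 (sum-map-∸-antitone (sym |A|≡|B|) B≤c A≤c (≤-reflexive (sym ΣA≡ΣB)))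
                                 (sum-map-∸-antitone |A|≡|B| A≤c B≤c (≤-reflexive ΣA≡ΣB)) ⟩
    sum (map (c ∸_) B)      ≡⟨ sum-complementSeq c B ⟨
    sum (complementSeq c B) ∎
    where open ≤-Reasoning
  prefix : ∀ j → sum (take j (complementSeq c B)) ≤ sum (take j (complementSeq c A))
  prefix j with j ≤? length A
  ... | yes j≤|A| = begin
    sum (take j (complementSeq c B))          ≡⟨ sum-take-complementSeq c B j (subst (j ≤_) |A|≡|B| j≤|A|) ⟩
    sum (map (c ∸_) (drop (length B ∸ j) B)) ≡⟨ cong (λ m → sum (map (c ∸_) (drop (m ∸ j) B))) |A|≡|B| ⟨
    sum (map (c ∸_) (drop i B))              ≤⟨ sum-map-∸-antitone |drop-A|≡|drop-B| (AllP.drop⁺ i A≤c)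
                                                  (AllP.drop⁺ i B≤c) (sum-drop-≤ A≽B i) ⟩
    sum (map (c ∸_) (drop i A))              ≡⟨ sum-take-complementSeq c A j j≤|A| ⟨
    sum (take j (complementSeq c A))          ∎
    where
    open ≤-Reasoning
    i : ℕ
    i = length A ∸ j
    |drop-A|≡|drop-B| : length (drop i A) ≡ length (drop i B)
    |drop-A|≡|drop-B| = trans (length-drop i A) (trans (cong (_∸ i) |A|≡|B|) (sym (length-drop i B)))
  ... | no j≰|A| = ≤-reflexive (begin
    sum (take j (complementSeq c B)) ≡⟨ cong sum (take-all j _ (|complementSeq|≤j B |A|≡|B|)) ⟩
    sum (complementSeq c B)          ≡⟨ Σ≡ ⟨
    sum (complementSeq c A)          ≡⟨ cong sum (take-all j _ (|complementSeq|≤j A refl)) ⟨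
    sum (take j (complementSeq c A)) ∎)
    where
    open ≡-Reasoning
    |complementSeq|≤j : ∀ L → length A ≡ length L → length (complementSeq c L) ≤ j
    |complementSeq|≤j L |A|≡|L| =
      subst (_≤ j) (trans |A|≡|L| (sym (length-complementSeq c L))) (<⇒≤ (≰⇒> j≰|A|))

++-zeros-bounded : ∀ {L} k {c} → All (_< length L) L → length L + k ≡ suc c →
  All (_≤ c) (L ++ replicate k 0)
++-zeros-bounded {L} k {c} L< |L|+k≡1+c =
  AllP.++⁺ (All.map (λ x<|L| → s≤s⁻¹ (≤-trans x<|L| |L|≤1+c)) L<) (AllP.replicate⁺ k z≤n)
  where
  |L|≤1+c : length L ≤ suc c
  |L|≤1+c = ≤-trans (m≤m+n (length L) k) (≤-reflexive |L|+k≡1+c)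

complementSeq-⪰ : ∀ {d e} k l {c} → All (_< length d) d → All (_< length e) e → d ⪰ e →
  length d + k ≡ suc c → length e + l ≡ suc c →
  complementSeq c (d ++ replicate k 0) ⪰ complementSeq c (e ++ replicate l 0)
complementSeq-⪰ {d} {e} k l d< e< d⪰e |d|+k≡1+c |e|+l≡1+c = ≽⇒⪰ (complementSeq-≽
  (trans (length-++-replicate d k |d|+k≡1+c) (sym (length-++-replicate e l |e|+l≡1+c)))
  (++-zeros-bounded k d< |d|+k≡1+c) (++-zeros-bounded l e< |e|+l≡1+c)
  (≽-++-zeros k l (⪰⇒≽ d⪰e)))

isDegSeq-complementSeq : ∀ {L} k {c} → IsDegSeq L → length L + suc k ≡ suc c → 0 < c →
  IsDegSeq (complementSeq c (L ++ replicate (suc k) 0))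
isDegSeq-complementSeq {L} k {c} L-deg@(L↘ , _ , G , G⇒L) |L|+1+k≡1+c 0<c =
  complementSeq-nonIncreasing c (++-zeros-nonIncreasing (suc k) L↘) ,
  complementSeq-positive (AllP.++⁺ (All.map (λ x<|L| → <-≤-trans x<|L| |L|≤c) (isDegSeq⇒bounded L-deg))
                                   (AllP.replicate⁺ (suc k) 0<c)) ,
  complement (addIsolated G (suc k)) , complement-addIsolated-realizes (suc k) G⇒L |L|+1+k≡1+c
  where
  |L|≤c : length L ≤ c
  |L|≤c = ≤-trans (m≤m+n (length L) k)
                  (≤-reflexive (suc-injective (trans (sym (+-suc (length L) k)) |L|+1+k≡1+c)))

private
  ∸-shift : ∀ {x p k c} → x < p → p + k ≡ suc c → c ∸ x ≡ (p ∸ 1 ∸ x) + k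
  ∸-shift {p = suc q} {k} (s≤s x≤q) refl = +-∸-comm k x≤q

  ∸-involutive : ∀ {x p} → x < p → p ∸ 1 ∸ (p ∸ 1 ∸ x) ≡ x
  ∸-involutive {p = suc q} (s≤s x≤q) = m∸[m∸n]≡n x≤q

complementSeq-++-zeros-↭ : ∀ {e} k {c} → All (_< length e) e → length e + k ≡ suc c →
  complementSeq c (e ++ replicate k 0) ↭ replicate k c ++ map (_+ k) (map (length e ∸ 1 ∸_) e)
complementSeq-++-zeros-↭ {e} k {c} e< |e|+k≡1+c = begin
  complementSeq c (e ++ replicate k 0)       ↭⟨ ↭-reverse (map (c ∸_) (e ++ replicate k 0)) ⟩
  map (c ∸_) (e ++ replicate k 0)            ≡⟨ map-++ (c ∸_) e (replicate k 0) ⟩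
  map (c ∸_) e ++ map (c ∸_) (replicate k 0) ↭⟨ ++-comm (map (c ∸_) e) (map (c ∸_) (replicate k 0)) ⟩
  map (c ∸_) (replicate k 0) ++ map (c ∸_) e ≡⟨ cong₂ _++_ (map-replicate (c ∸_) k 0) c∸e≡β+k ⟩
  replicate k c ++ map (_+ k) (map (length e ∸ 1 ∸_) e) ∎
  where
  open PermutationReasoning
  c∸e≡β+k : map (c ∸_) e ≡ map (_+ k) (map (length e ∸ 1 ∸_) e)
  c∸e≡β+k = trans (map-cong-local (All.map (λ x<p → ∸-shift x<p |e|+k≡1+c) e<)) (map-∘ e)

-- A realization of the padded complement sequence has k dominating vertices; deleting them
-- leaves a graph whose complement realizes e.
forciblyFree-complementSeq : ∀ {𝓕 e} k {c} → (∀ F → 𝓕 F → ¬ HasDominatingVertex F) →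
  All (_< length e) e → ForciblyFree (ComplementSet 𝓕) e → length e + k ≡ suc c →
  ForciblyFree 𝓕 (complementSeq c (e ++ replicate k 0))
forciblyFree-complementSeq {e = e} k {c} nodom e< e-free |e|+k≡1+c X X⇒ F F∈𝓕 X⊇F =
  e-free (complement Y) Ȳ⇒e (complement F) (F , F∈𝓕 , refl) (complement-⊇ Y F Y⊇F)
  where
  p : ℕ
  p = length e
  β : List ℕ
  β = map (p ∸ 1 ∸_) e
  nX≡1+c : n X ≡ suc c
  nX≡1+c = trans (realizes⇒length X X⇒)
    (trans (length-complementSeq c (e ++ replicate k 0)) (length-++-replicate e k |e|+k≡1+c))
  X↭ : degrees X ↭ replicate k (n X ∸ 1) ++ map (_+ k) β
  X↭ = subst (λ m → degrees X ↭ replicate k (m ∸ 1) ++ map (_+ k) β) (sym nX≡1+c)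
             (↭-trans X⇒ (complementSeq-++-zeros-↭ k e< |e|+k≡1+c))
  deletion : Σ Graph λ Y → degrees Y ↭ β × ContainsInduced Y F
  deletion = deleteDominatingVertices k β X X↭ F (nodom F F∈𝓕) X⊇F
  Y : Graph
  Y = proj₁ deletion
  Y⇒β : Realizes Y β
  Y⇒β = proj₁ (proj₂ deletion)
  Y⊇F : ContainsInduced Y F
  Y⊇F = proj₂ (proj₂ deletion)
  nY≡p : n Y ≡ p
  nY≡p = trans (realizes⇒length Y Y⇒β) (length-map (p ∸ 1 ∸_) e)
  Ȳ⇒e : Realizes (complement Y) e
  Ȳ⇒e = begin
    degrees (complement Y)              ≡⟨ degrees-complement Y ⟩
    map ((n Y ∸ 1) ∸_) (degrees Y)      ↭⟨ map⁺ ((n Y ∸ 1) ∸_) Y⇒β ⟩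
    map ((n Y ∸ 1) ∸_) β                ≡⟨ cong (λ m → map ((m ∸ 1) ∸_) β) nY≡p ⟩
    map (p ∸ 1 ∸_) β                    ≡⟨ map-∘ e ⟨
    map (λ x → p ∸ 1 ∸ (p ∸ 1 ∸ x)) e   ≡⟨ map-id-local (All.map ∸-involutive e<) ⟩
    e                                   ∎
    where open PermutationReasoning

theorem3p1 : (𝓕 : GraphSet) → DominanceMonotone 𝓕 →
    (∀ F → 𝓕 F → ¬ HasDominatingVertex F) →
    DominanceMonotone (ComplementSet 𝓕)
theorem3p1 𝓕 mono nodom d [] (_ , d⁺ , _) _ (Σd≡0 , _) e-free =
  subst (ForciblyFree (ComplementSet 𝓕)) (sym (Positive-sum≡0⇒[] d⁺ Σd≡0)) e-free
theorem3p1 𝓕 mono nodom d e@(_ ∷ _) d-deg e-deg d⪰e e-free G G⇒d _ (F , F∈𝓕 , refl) G⊇F̄ =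
  mono d′ e′
    (isDegSeq-complementSeq p d-deg |d|+1+p≡1+c 0<c)
    (isDegSeq-complementSeq m e-deg |e|+1+m≡1+c 0<c)
    (complementSeq-⪰ (suc p) (suc m) (isDegSeq⇒bounded d-deg) (isDegSeq⇒bounded e-deg) d⪰e
                     |d|+1+p≡1+c |e|+1+m≡1+c)
    (forciblyFree-complementSeq (suc m) nodom (isDegSeq⇒bounded e-deg) e-free |e|+1+m≡1+c)
    K (complement-addIsolated-realizes (suc p) G⇒d |d|+1+p≡1+c) F F∈𝓕 K⊇F
  where
  m p c : ℕ
  m = length d
  p = length e
  c = m + p
  d′ e′ : List ℕ
  d′ = complementSeq c (d ++ replicate (suc p) 0)
  e′ = complementSeq c (e ++ replicate (suc m) 0)
  |d|+1+p≡1+c : m + suc p ≡ suc c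
  |d|+1+p≡1+c = +-suc m p
  |e|+1+m≡1+c : p + suc m ≡ suc c
  |e|+1+m≡1+c = trans (+-suc p m) (cong suc (+-comm p m))
  0<c : 0 < c
  0<c = ≤-trans (s≤s z≤n) (m≤n+m p m)
  K : Graph
  K = complement (addIsolated G (suc p))
  K⊇F : ContainsInduced K F
  K⊇F = ⊇-double-complement K F
          (complement-⊇ (addIsolated G (suc p)) (complement F) (⊇-addIsolated G (suc p) (complement F) G⊇F̄))
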